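{- Let $\mathbf g\in\mathrm{Ni}(A_n,\mathbf C_{3^r})$ and $i<j<k$ be indices such that (a) $\langle g_i,g_j,g_k\rangle$ acts transitively on a subset of $\{1,\dots,n\}$ of five integers, and (b) $g_ig_jg_k$ is a 3-cycle. Then $\mathbf g$ braids to some $\mathbf g'$ with $g'_2=(g'_1)^{ -1}$.
   Context: Permutations act on the right of integers. $\mathrm{Ni}(A_n,\mathbf C_{3^r})$ is the set of $r$-tuples $(g_1,\dots,g_r)$ of 3-cycles in $A_n$ with $g_1\cdots g_r=1$ and $\langle g_1,\dots,g_r\rangle=A_n$. $B_r$ (generators $Q_1,\dots,Q_{r-1}$) acts on the right by $(\mathbf g)Q_i=(g_1,\dots,g_{i-1},g_ig_{i+1}g_i^{ -1},g_i,g_{i+2},\dots,g_r)$; "$\mathbf g$ braids to $\mathbf g'$" means $\mathbf g'$ is in the $B_r$-orbit of $\mathbf g$. -}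

module Defs where

open import Data.Nat using (ℕ; zero; suc; _<_)
open import Data.Nat.Divisibility using (_∣_)
open import Data.Fin using (Fin; toℕ; _≟_)
import Data.Fin as F
open import Data.Fin.Permutation using (Permutation′; _⟨$⟩ʳ_; _≈_; id; flip; _∘ₚ_; transpose)
open import Data.Fin.Subset using (Subset; _∈_; ∣_∣)
open import Data.List using (List; []; _∷_; length)
open import Data.List.Relation.Unary.All using (All)
open import Data.Product using (Σ; ∃; ∃-syntax; _×_; _,_)
open import Relation.Binary.PropositionalEquality using (_≡_; _≢_)
open import Relation.Nullary using (yes; no)
open import Function.Bundles using (_⇔_)

Perm : ℕ → Set
Perm = Permutation′

-- Product with permutations acting on the RIGHT:  (x)(σ · τ) = ((x)σ)τ.
-- (stdlib's  σ ∘ₚ τ  applies σ first, then τ.)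
infixl 7 _·_
_·_ : ∀ {n} → Perm n → Perm n → Perm n
σ · τ = σ ∘ₚ τ

_⁻¹ : ∀ {n} → Perm n → Perm n
σ ⁻¹ = flip σ

prod : ∀ {n r} → (Fin r → Perm n) → Perm n
prod {r = zero}  g = id
prod {r = suc r} g = g F.zero · prod (λ x → g (F.suc x))

IsThreeCycle : ∀ {n} → Perm n → Set
IsThreeCycle {n} σ = ∃[ a ] ∃[ b ] ∃[ c ]
  ( a ≢ b × b ≢ c × a ≢ c
  × σ ⟨$⟩ʳ a ≡ b × σ ⟨$⟩ʳ b ≡ c × σ ⟨$⟩ʳ c ≡ a
  × (∀ (x : Fin n) → x ≢ a → x ≢ b → x ≢ c → σ ⟨$⟩ʳ x ≡ x))

data InGen {n} {I : Set} (gens : I → Perm n) : Perm n → Set where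
  gen-id  : InGen gens id
  gen-mul : ∀ {σ} (i : I) → InGen gens σ → InGen gens (σ · gens i)
  gen-inv : ∀ {σ} (i : I) → InGen gens σ → InGen gens (σ · (gens i) ⁻¹)
  gen-≈   : ∀ {σ τ} → InGen gens σ → σ ≈ τ → InGen gens τ

prodT : ∀ {n} → List (Fin n × Fin n) → Perm n
prodT []            = id
prodT ((a , b) ∷ t) = transpose a b · prodT t

IsEven : ∀ {n} → Perm n → Set
IsEven {n} σ = ∃[ t ] ( All (λ { (a , b) → a ≢ b }) t
                      × 2 ∣ length t
                      × σ ≈ prodT t )

GeneratesAlt : ∀ {n r} → (Fin r → Perm n) → Set
GeneratesAlt {n} g = ∀ (σ : Perm n) → InGen g σ ⇔ IsEven σ

InNi : (n r : ℕ) → (Fin r → Perm n) → Set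
InNi n r g = (∀ i → IsThreeCycle (g i)) × prod g ≈ id × GeneratesAlt g

-- Braid generator Q_i (positions a and b = a+1, 0-based) and its inverse:
--   (g)Q_a     = (…, g_a g_b g_a⁻¹, g_a, …)
--   (g)Q_a⁻¹   = (…, g_b, g_b⁻¹ g_a g_b, …)
Q : ∀ {n r} → (Fin r → Perm n) → (a b : Fin r) → Fin r → Perm n
Q g a b x with x ≟ a | x ≟ b
... | yes _ | _     = g a · g b · (g a) ⁻¹
... | no _  | yes _ = g a
... | no _  | no _  = g x

Qinv : ∀ {n r} → (Fin r → Perm n) → (a b : Fin r) → Fin r → Perm n
Qinv g a b x with x ≟ a | x ≟ b
... | yes _ | _     = g b
... | no _  | yes _ = (g b) ⁻¹ · g a · g b
... | no _  | no _  = g x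

_≋_ : ∀ {n r} → (Fin r → Perm n) → (Fin r → Perm n) → Set
g ≋ h = ∀ x → g x ≈ h x

data Braids {n r} : (Fin r → Perm n) → (Fin r → Perm n) → Set where
  br-refl : ∀ {g h} → g ≋ h → Braids g h
  br-Q    : ∀ {g h} (a b : Fin r) → toℕ b ≡ suc (toℕ a) →
            Braids (Q g a b) h → Braids g h
  br-Qinv : ∀ {g h} (a b : Fin r) → toℕ b ≡ suc (toℕ a) →
            Braids (Qinv g a b) h → Braids g h

TransOnFive : ∀ {n} → Perm n → Perm n → Perm n → Set
TransOnFive {n} x y z =
  ∃[ S ] ( ∣ S ∣ ≡ 5
         × (∀ (p : Fin n) → p ∈ S → x ⟨$⟩ʳ p ∈ S × y ⟨$⟩ʳ p ∈ S × z ⟨$⟩ʳ p ∈ S)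
         × (∀ (p q : Fin n) → p ∈ S → q ∈ S →
              ∃[ σ ] (InGen three σ × σ ⟨$⟩ʳ p ≡ q)) )
  where
  three : Fin 3 → Perm n
  three F.zero = x
  three (F.suc F.zero) = y
  three (F.suc (F.suc F.zero)) = z

-- Pulling g_i, g_j, g_k to the front of the tuple (each step conjugates only the entries
-- passed over) reduces the lemma to three adjacent 3-cycles σ₀ = (a₀ b₀ c₀), σ₁, σ₂ at
-- positions 0, 1, 2. How the braid group acts on them depends only on which of the nine
-- points a₀, …, c₂ coincide, so there are finitely many cases: writing each point as the
-- largest of its nine labels gives a canonical pattern, and every pattern arising from
-- three 3-cycles is found by a pruned exhaustive search. For each pattern whose product
-- is a 3-cycle and which has at least five distinct points (transitivity on a 5-set
-- forces that), some braid word of length at most 3 in Q₁^±1, Q₂^±1 makes the first two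
-- entries mutually inverse. Computing with the labels instead of the points is sound
-- because every permutation involved fixes all points outside {a₀, …, c₂}.

module Submission where

open import Data.Bool.Base using (Bool; true; false; T; not; _∧_; _∨_)
open import Data.Bool.ListAction using (all; any)
open import Data.Fin.Base using (Fin; zero; suc; toℕ; fromℕ<)
open import Data.Fin.Patterns using (0F; 1F; 2F; 3F; 4F; 5F; 6F; 7F; 8F)
open import Data.Fin.Permutation using (_⟨$⟩ʳ_; _⟨$⟩ˡ_; _≈_; inverseˡ; inverseʳ)
open import Data.Fin.Properties using (_≟_; toℕ-injective; toℕ<n; toℕ-fromℕ<; <⇒≢; all?; any?)
open import Data.Fin.Subset using (Subset; _∈_; _⊆_; ∣_∣; ⁅_⁆; _∪_; ⋃; inside; outside)
open import Data.Fin.Subset.Properties using (∣⊥∣≡0; ∣⁅x⁆∣≡1; p⊆q⇒∣p∣≤∣q∣; x∈⁅x⁆; x∈p∪q⁺)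
open import Data.List.Base using (List; []; _∷_; [_]; length; map; filter; allFin; cartesianProductWith)
open import Data.List.Membership.Propositional using (lose) renaming (_∈_ to _∈ᴸ_)
open import Data.List.Membership.Propositional.Properties using (∈-filter⁺; ∈-allFin)
open import Data.List.Relation.Unary.All as All using ()
open import Data.List.Relation.Unary.All.Properties using (all⁺; all⁻)
open import Data.List.Relation.Unary.Any using (here; there; satisfied)
open import Data.List.Relation.Unary.Any.Properties using (any⁺; any⁻)
open import Data.Nat.Base using (ℕ; zero; suc; _+_; _∸_; _≤_; _<_; _<ᵇ_; z≤n; s≤s)
open import Data.Nat.Properties
  using (_≤?_; _<?_; ≤-refl; ≤-reflexive; ≤-trans; <-trans; <⇒≤; <⇒≱; ≤∧≢⇒<; n<1+n; n≤1+n;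
         m≤n+m; m∸n+n≡m; +-suc; +-monoʳ-≤; <ᵇ⇒<; module ≤-Reasoning)
open import Data.Product using (∃-syntax; ∄-syntax; _×_; _,_; proj₁; proj₂)
open import Data.Sum using (_⊎_; inj₁; inj₂; [_,_]′)
open import Data.Unit using (tt)
open import Data.Vec.Base using (Vec; []; _∷_; lookup; tabulate; replicate; _[_]≔_)
open import Data.Vec.Properties
  using (lookup∘tabulate; tabulate∘lookup; tabulate-cong; lookup∘update; lookup∘update′)
open import Function using (_∘_)
open import Relation.Binary.PropositionalEquality
  using (_≡_; _≢_; refl; sym; trans; cong; subst; ≢-sym; module ≡-Reasoning)
open import Relation.Nullary using (Dec; yes; no; ¬_; contradiction; ¬?; _×-dec_; _→-dec_)
open import Relation.Nullary.Decidable using (isYes; T?; from-yes; toWitness)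
open import Relation.Unary using (Pred; Decidable)

open import Defs

private
  variable
    n r : ℕ

-- Braid moves

⟨$⟩ʳ⇒⟨$⟩ˡ : (σ : Perm n) {x y : Fin n} → σ ⟨$⟩ʳ x ≡ y → σ ⟨$⟩ˡ y ≡ x
⟨$⟩ʳ⇒⟨$⟩ˡ σ refl = inverseˡ σ

⁻¹-cong : (σ τ : Perm n) → σ ≈ τ → σ ⁻¹ ≈ τ ⁻¹
⁻¹-cong σ τ σ≈τ y = begin
  σ ⟨$⟩ˡ y                   ≡⟨ cong (σ ⟨$⟩ˡ_) (sym (inverseʳ τ)) ⟩
  σ ⟨$⟩ˡ (τ ⟨$⟩ʳ (τ ⟨$⟩ˡ y)) ≡⟨ ⟨$⟩ʳ⇒⟨$⟩ˡ σ (σ≈τ _) ⟩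
  τ ⟨$⟩ˡ y                   ∎
  where open ≡-Reasoning

Q-cong : {g g′ : Fin r → Perm n} → g ≋ g′ → ∀ a b → Q g a b ≋ Q g′ a b
Q-cong {g = g} {g′} g≋g′ a b x with x ≟ a | x ≟ b
... | yes _ | _     = λ y → trans (cong (g a ⟨$⟩ˡ_) (trans (cong (g b ⟨$⟩ʳ_) (g≋g′ a y)) (g≋g′ b _)))
                                  (⁻¹-cong (g a) (g′ a) (g≋g′ a) _)
... | no _  | yes _ = g≋g′ a
... | no _  | no _  = g≋g′ x

Qinv-cong : {g g′ : Fin r → Perm n} → g ≋ g′ → ∀ a b → Qinv g a b ≋ Qinv g′ a b
Qinv-cong {g = g} {g′} g≋g′ a b x with x ≟ a | x ≟ b
... | yes _ | _     = g≋g′ b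
... | no _  | yes _ = λ y →
  trans (cong (g b ⟨$⟩ʳ_) (trans (cong (g a ⟨$⟩ʳ_) (⁻¹-cong (g b) (g′ b) (g≋g′ b) y)) (g≋g′ a _)))
        (g≋g′ b _)
... | no _  | no _  = g≋g′ x

Braids-respˡ : {g g′ h : Fin r → Perm n} → g ≋ g′ → Braids g′ h → Braids g h
Braids-respˡ g≋g′ (br-refl g′≋h)    = br-refl (λ x y → trans (g≋g′ x y) (g′≋h x y))
Braids-respˡ g≋g′ (br-Q a b e q)    = br-Q a b e (Braids-respˡ (Q-cong g≋g′ a b) q)
Braids-respˡ g≋g′ (br-Qinv a b e q) = br-Qinv a b e (Braids-respˡ (Qinv-cong g≋g′ a b) q)

Braids-trans : {g h k : Fin r → Perm n} → Braids g h → Braids h k → Braids g k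
Braids-trans (br-refl g≋h)       h→k = Braids-respˡ g≋h h→k
Braids-trans (br-Q a b e g→h)    h→k = br-Q a b e (Braids-trans g→h h→k)
Braids-trans (br-Qinv a b e g→h) h→k = br-Qinv a b e (Braids-trans g→h h→k)

Qinv-at-fst : (g : Fin r → Perm n) (a b : Fin r) → Qinv g a b a ≡ g b
Qinv-at-fst g a b with a ≟ a
... | yes _  = refl
... | no a≢a = contradiction refl a≢a

Qinv-elsewhere : (g : Fin r → Perm n) {a b x : Fin r} → x ≢ a → x ≢ b → Qinv g a b x ≡ g x
Qinv-elsewhere g {a} {b} {x} x≢a x≢b with x ≟ a | x ≟ b
... | yes x≡a | _       = contradiction x≡a x≢a
... | no _    | yes x≡b = contradiction x≡b x≢b
... | no _    | no _    = refl

pullLeftBy : ∀ d (g : Fin r → Perm n) (t s : Fin r) → toℕ s ≡ d + toℕ t →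
  ∃[ h ] Braids g h × h t ≡ g s
       × (∀ x → toℕ x < toℕ t → h x ≡ g x) × (∀ x → toℕ s < toℕ x → h x ≡ g x)
pullLeftBy zero g t s s≡t with toℕ-injective s≡t
... | refl = g , br-refl (λ _ _ → refl) , refl , (λ _ _ → refl) , (λ _ _ → refl)
pullLeftBy {r = r} (suc d) g t s s≡ =
  let h , g′→h , h[t] , left , right = pullLeftBy d (Qinv g s′ s) t s′ s′≡ in
  h , br-Qinv s′ s s≡1+s′ g′→h , trans h[t] (Qinv-at-fst g s′ s)
    , (λ x x<t → let x<s′ = ≤-trans x<t t≤s′ in
         trans (left x x<t) (Qinv-elsewhere g (<⇒≢ x<s′) (<⇒≢ (<-trans x<s′ s′<s))))
    , (λ x s<x → let s′<x = <-trans s′<s s<x in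
         trans (right x s′<x) (Qinv-elsewhere g (≢-sym (<⇒≢ s′<x)) (≢-sym (<⇒≢ s<x))))
  where
  s′<r : d + toℕ t < r
  s′<r = subst (_≤ r) s≡ (<⇒≤ (toℕ<n s))
  s′ : Fin r
  s′ = fromℕ< s′<r
  s′≡ : toℕ s′ ≡ d + toℕ t
  s′≡ = toℕ-fromℕ< s′<r
  s≡1+s′ : toℕ s ≡ suc (toℕ s′)
  s≡1+s′ = trans s≡ (cong suc (sym s′≡))
  s′<s : toℕ s′ < toℕ s
  s′<s = subst (toℕ s′ <_) (sym s≡1+s′) (n<1+n _)
  t≤s′ : toℕ t ≤ toℕ s′
  t≤s′ = subst (toℕ t ≤_) (sym s′≡) (m≤n+m (toℕ t) d)

pullLeft : (g : Fin r → Perm n) (t s : Fin r) → toℕ t ≤ toℕ s →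
  ∃[ h ] Braids g h × h t ≡ g s
       × (∀ x → toℕ x < toℕ t → h x ≡ g x) × (∀ x → toℕ s < toℕ x → h x ≡ g x)
pullLeft g t s t≤s = pullLeftBy (toℕ s ∸ toℕ t) g t s (sym (m∸n+n≡m t≤s))

gather : (g : Fin (3 + r) → Perm n) (i j k : Fin (3 + r)) → toℕ i < toℕ j → toℕ j < toℕ k →
  ∃[ h ] Braids g h × h 0F ≡ g i × h 1F ≡ g j × h 2F ≡ g k
gather g i j k i<j j<k =
  let h₁ , g→h₁  , h₁[0]≡g[i] , _     , h₁>i = pullLeft g  0F i z≤n
      h₂ , h₁→h₂ , h₂[1]≡h₁[j] , h₂<1 , h₂>j = pullLeft h₁ 1F j 1≤j
      h₃ , h₂→h₃ , h₃[2]≡h₂[k] , h₃<2 , _    = pullLeft h₂ 2F k (≤-trans (s≤s 1≤j) j<k)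
  in h₃ , Braids-trans g→h₁ (Braids-trans h₁→h₂ h₂→h₃)
     , trans (h₃<2 0F (s≤s z≤n)) (trans (h₂<1 0F (s≤s z≤n)) h₁[0]≡g[i])
     , trans (h₃<2 1F (s≤s (s≤s z≤n))) (trans h₂[1]≡h₁[j] (h₁>i j i<j))
     , trans h₃[2]≡h₂[k] (trans (h₂>j k j<k) (h₁>i k (<-trans i<j j<k)))
  where
  1≤j : 1 ≤ toℕ j
  1≤j = ≤-trans (s≤s z≤n) i<j

-- Counting points

InGen-fixes : ∀ {I : Set} {gens : I → Perm n} {σ y} → InGen gens σ →
              (∀ t → gens t ⟨$⟩ʳ y ≡ y) → σ ⟨$⟩ʳ y ≡ y
InGen-fixes gen-id fixed = refl
InGen-fixes {gens = gens} (gen-mul t σ∈) fixed =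
  trans (cong (gens t ⟨$⟩ʳ_) (InGen-fixes σ∈ fixed)) (fixed t)
InGen-fixes {gens = gens} (gen-inv t σ∈) fixed =
  trans (cong (gens t ⟨$⟩ˡ_) (InGen-fixes σ∈ fixed)) (⟨$⟩ʳ⇒⟨$⟩ˡ (gens t) (fixed t))
InGen-fixes (gen-≈ σ∈ σ≈τ) fixed = trans (sym (σ≈τ _)) (InGen-fixes σ∈ fixed)

∣p∪q∣≤∣p∣+∣q∣ : ∀ {k} (p q : Subset k) → ∣ p ∪ q ∣ ≤ ∣ p ∣ + ∣ q ∣
∣p∪q∣≤∣p∣+∣q∣ []            []            = z≤n
∣p∪q∣≤∣p∣+∣q∣ (inside ∷ p)  (inside ∷ q)  =
  s≤s (≤-trans (∣p∪q∣≤∣p∣+∣q∣ p q) (+-monoʳ-≤ ∣ p ∣ (n≤1+n ∣ q ∣)))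
∣p∪q∣≤∣p∣+∣q∣ (inside ∷ p)  (outside ∷ q) = s≤s (∣p∪q∣≤∣p∣+∣q∣ p q)
∣p∪q∣≤∣p∣+∣q∣ (outside ∷ p) (inside ∷ q)  rewrite +-suc ∣ p ∣ ∣ q ∣ = s≤s (∣p∪q∣≤∣p∣+∣q∣ p q)
∣p∪q∣≤∣p∣+∣q∣ (outside ∷ p) (outside ∷ q) = ∣p∪q∣≤∣p∣+∣q∣ p q

image : ∀ {A : Set} {k} → (A → Fin k) → List A → Subset k
image f xs = ⋃ (map (⁅_⁆ ∘ f) xs)

∣image∣≤length : ∀ {A : Set} {k} (f : A → Fin k) xs → ∣ image f xs ∣ ≤ length xs
∣image∣≤length {k = k} f []       = ≤-reflexive (∣⊥∣≡0 k)
∣image∣≤length         f (x ∷ xs) = begin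
  ∣ ⁅ f x ⁆ ∪ image f xs ∣     ≤⟨ ∣p∪q∣≤∣p∣+∣q∣ ⁅ f x ⁆ (image f xs) ⟩
  ∣ ⁅ f x ⁆ ∣ + ∣ image f xs ∣ ≡⟨ cong (_+ ∣ image f xs ∣) (∣⁅x⁆∣≡1 (f x)) ⟩
  suc ∣ image f xs ∣           ≤⟨ s≤s (∣image∣≤length f xs) ⟩
  suc (length xs)              ∎
  where open ≤-Reasoning

∈-image : ∀ {A : Set} {k} (f : A → Fin k) {x xs} → x ∈ᴸ xs → f x ∈ image f xs
∈-image f (here refl)  = x∈p∪q⁺ (inj₁ (x∈⁅x⁆ (f _)))
∈-image f (there x∈xs) = x∈p∪q⁺ (inj₂ (∈-image f x∈xs))

-- Opaque, like threeCycleShapedᵇ below: unfolding them in goals produces enormous terms.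
opaque
  -- The greatest index satisfying P, or zero if there is none.
  greatest : ∀ {k p} {P : Pred (Fin (suc k)) p} → Decidable P → Fin (suc k)
  greatest {zero}  P? = zero
  greatest {suc k} P? with P? (suc (greatest (P? ∘ suc)))
  ... | yes _ = suc (greatest (P? ∘ suc))
  ... | no _  = zero

  greatest-satisfies : ∀ {k p} {P : Pred (Fin (suc k)) p} (P? : Decidable P) {i} →
                       P i → P (greatest P?)
  greatest-satisfies {zero}  P? {zero}  P[0] = P[0]
  greatest-satisfies {suc k} P? {zero}  P[0] with P? (suc (greatest (P? ∘ suc)))
  ... | yes P[j] = P[j]
  ... | no _     = P[0]
  greatest-satisfies {suc k} P? {suc i} P[i] with P? (suc (greatest (P? ∘ suc)))
  ... | yes P[j]  = P[j]
  ... | no ¬P[j] = contradiction (greatest-satisfies (P? ∘ suc) P[i]) ¬P[j]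

  greatest-≥ : ∀ {k p} {P : Pred (Fin (suc k)) p} (P? : Decidable P) {i} →
               P i → toℕ i ≤ toℕ (greatest P?)
  greatest-≥         P? {zero}  _    = z≤n
  greatest-≥ {suc k} P? {suc i} P[i] with P? (suc (greatest (P? ∘ suc)))
  ... | yes _     = s≤s (greatest-≥ (P? ∘ suc) P[i])
  ... | no ¬P[j] = contradiction (greatest-satisfies (P? ∘ suc) P[i]) ¬P[j]

-- Exhaustive search

allFin-sound : ∀ {k} (p : Fin k → Bool) → T (all p (allFin k)) → ∀ i → T (p i)
allFin-sound p ok i = All.lookup (all⁺ p (allFin _) ok) (∈-allFin i)

allFin-complete : ∀ {k} (p : Fin k → Bool) → (∀ i → T (p i)) → T (all p (allFin k))
allFin-complete p ok = all⁻ p {xs = allFin _} (All.tabulate λ {i} _ → ok i)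

anyFin-complete : ∀ {k} (p : Fin k → Bool) i → T (p i) → T (any p (allFin k))
anyFin-complete p i ok = any⁺ p (lose (∈-allFin i) ok)

resolve : ∀ x y z → T (not x ∨ y ∨ z) → T x → ¬ T y → T z
resolve true  false z z-holds _  _  = z-holds
resolve true  true  z _       _  ¬y = contradiction tt ¬y
resolve false y     z _       () _

module PrunedSearch {K N : ℕ}
  (Admissible : Fin N → Vec (Fin K) N → Set) (Accept : Vec (Fin K) N → Set)
  (admissible? : ∀ p v → Dec (Admissible p v)) (accept? : ∀ v → Dec (Accept v)) where

  Extensions : ∀ d → .(d ≤ N) → Vec (Fin K) N → Set
  Extensions zero    _   v = Accept v
  Extensions (suc d) d<N v =
    ∀ x → Admissible p (v [ p ]≔ x) → Extensions d (<⇒≤ d<N) (v [ p ]≔ x)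
    where
    p : Fin N
    p = fromℕ< d<N

  extensions? : ∀ d .(d≤N : d ≤ N) v → Dec (Extensions d d≤N v)
  extensions? zero    _   v = accept? v
  extensions? (suc d) d<N v =
    all? λ x → admissible? p (v [ p ]≔ x) →-dec extensions? d (<⇒≤ d<N) (v [ p ]≔ x)
    where
    p : Fin N
    p = fromℕ< d<N

  -- The search tests Admissible p on vectors that agree with the final one only at
  -- positions ≥ p.
  LocallyAdmissible : Vec (Fin K) N → Set
  LocallyAdmissible w = ∀ p v → (∀ q → toℕ p ≤ toℕ q → lookup v q ≡ lookup w q) → Admissible p v

  extensions-sound : ∀ {w} → LocallyAdmissible w → ∀ d .(d≤N : d ≤ N) v →
    (∀ q → d ≤ toℕ q → lookup v q ≡ lookup w q) → Extensions d d≤N v → Accept w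
  extensions-sound {w} _ zero _ v v≗w accepted = subst Accept v≡w accepted
    where
    v≡w : v ≡ w
    v≡w = trans (sym (tabulate∘lookup v)) (trans (tabulate-cong (λ q → v≗w q z≤n)) (tabulate∘lookup w))
  extensions-sound {w} admissible (suc d) d<N v agree extensions =
    extensions-sound admissible d _ v′ agree′
      (extensions (lookup w p) (admissible p v′ (λ q → agree′ q ∘ ≤-trans d≤p)))
    where
    p : Fin N
    p = fromℕ< d<N
    v′ : Vec (Fin K) N
    v′ = v [ p ]≔ lookup w p
    d≤p : d ≤ toℕ p
    d≤p = ≤-reflexive (sym (toℕ-fromℕ< d<N))
    agree′ : ∀ q → d ≤ toℕ q → lookup v′ q ≡ lookup w q
    agree′ q d≤q with q ≟ p
    ... | yes refl = lookup∘update p v (lookup w p)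
    ... | no q≢p   = trans (lookup∘update′ q≢p v (lookup w p)) (agree q (≤∧≢⇒< d≤q d≢q))
      where
      d≢q : d ≢ toℕ q
      d≢q d≡q = q≢p (toℕ-injective (trans (sym d≡q) (sym (toℕ-fromℕ< d<N))))

-- Permutations of nine labels

Label : Set
Label = Fin 9

-- Labels 3t, 3t+1, 3t+2 name the points a, b, c of the t-th 3-cycle (a b c). A pattern v
-- records which of the nine points coincide: m and m′ name the same point iff v[m] ≡ v[m′].
Pattern : Set
Pattern = Vec Label 9

next : Label → Label
next 0F = 1F
next 1F = 2F
next 2F = 0F
next 3F = 4F
next 4F = 5F
next 5F = 3F
next 6F = 7F
next 7F = 8F
next 8F = 6F

-- Tables rather than functions, so that the entries of a product are computed only once.
record LabelPerm : Set where
  constructor _⇄_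
  field
    toTable fromTable : Vec Label 9

  to from : Label → Label
  to   = lookup toTable
  from = lookup fromTable

open LabelPerm

infixl 7 _⊙_
_⊙_ : LabelPerm → LabelPerm → LabelPerm
F ⊙ G = tabulate (to G ∘ to F) ⇄ tabulate (from F ∘ from G)

_⁻¹ᴸ : LabelPerm → LabelPerm
F ⁻¹ᴸ = fromTable F ⇄ toTable F

Triple : Set
Triple = LabelPerm × LabelPerm × LabelPerm

data Move : Set where
  Q₁ Q₁⁻¹ Q₂ Q₂⁻¹ : Move

stepᴸ : Move → Triple → Triple
stepᴸ Q₁   (A , B , C) = A ⊙ B ⊙ A ⁻¹ᴸ , A , C
stepᴸ Q₁⁻¹ (A , B , C) = B , B ⁻¹ᴸ ⊙ A ⊙ B , C
stepᴸ Q₂   (A , B , C) = A , B ⊙ C ⊙ B ⁻¹ᴸ , B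
stepᴸ Q₂⁻¹ (A , B , C) = A , C , C ⁻¹ᴸ ⊙ B ⊙ C

runᴸ : List Move → Triple → Triple
runᴸ []      t = t
runᴸ (μ ∷ w) t = runᴸ w (stepᴸ μ t)

wordsUpTo : ℕ → List (List Move)
wordsUpTo zero    = [ [] ]
wordsUpTo (suc k) = [] ∷ cartesianProductWith _∷_ (Q₁ ∷ Q₁⁻¹ ∷ Q₂ ∷ Q₂⁻¹ ∷ []) (wordsUpTo k)

module OnPattern (v : Pattern) where

  infix 4 _∼_ _∼?_
  _∼_ : Label → Label → Set
  m ∼ m′ = lookup v m ≡ lookup v m′

  _∼?_ : ∀ m m′ → Dec (m ∼ m′)
  m ∼? m′ = lookup v m ≟ lookup v m′

  rotate : Label → Label → Label → Label → Label
  rotate i j k m with m ∼? i | m ∼? j | m ∼? k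
  ... | yes _ | _     | _     = j
  ... | no _  | yes _ | _     = k
  ... | no _  | no _  | yes _ = i
  ... | no _  | no _  | no _  = m

  cycleᴸ : Label → Label → Label → LabelPerm
  cycleᴸ i j k = tabulate (rotate i j k) ⇄ tabulate (rotate k j i)

  generators : Triple
  generators = cycleᴸ 0F 1F 2F , cycleᴸ 3F 4F 5F , cycleᴸ 6F 7F 8F

  product : Triple → LabelPerm
  product (A , B , C) = A ⊙ B ⊙ C

  InversePair : Triple → Set
  InversePair (A , B , _) = ∀ m → to B m ∼ from A m

  ThreeCycleShaped : LabelPerm → Set
  ThreeCycleShaped P = ∃[ m ] ¬ (to P m ∼ m)
    × (∀ m′ → m′ ∼ m ⊎ m′ ∼ to P m ⊎ m′ ∼ to P (to P m) ⊎ to P m′ ∼ m′)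

  classes : List Label
  classes = filter (λ m → lookup v m ≟ m) (allFin 9)

  Solvable : Set
  Solvable = ThreeCycleShaped (product generators) → 5 ≤ length classes →
             ∃[ w ] InversePair (runᴸ w generators)

  infix 7 _≐_
  _≐_ : Label → Label → Bool
  m ≐ m′ = isYes (m ∼? m′)

  inversePairᵇ : Triple → Bool
  inversePairᵇ (A , B , _) = all (λ m → to B m ≐ from A m) (allFin 9)

  coveredBy : LabelPerm → Label → Label → Bool
  coveredBy P m m′ = m′ ≐ m ∨ m′ ≐ to P m ∨ m′ ≐ to P (to P m) ∨ to P m′ ≐ m′

  shapedAt : LabelPerm → Label → Bool
  shapedAt P m = not (to P m ≐ m) ∧ all (coveredBy P m) (allFin 9)

  opaque
    threeCycleShapedᵇ : LabelPerm → Bool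
    threeCycleShapedᵇ P = any (shapedAt P) (allFin 9)

    threeCycleShapedᵇ-complete : ∀ P → ThreeCycleShaped P → T (threeCycleShapedᵇ P)
    threeCycleShapedᵇ-complete P (m , moved , covered) = anyFin-complete (shapedAt P) m shaped
      where
      decide : ∀ m′ → m′ ∼ m ⊎ m′ ∼ to P m ⊎ m′ ∼ to P (to P m) ⊎ to P m′ ∼ m′ →
               T (coveredBy P m m′)
      decide m′ c with m′ ∼? m | m′ ∼? to P m | m′ ∼? to P (to P m) | to P m′ ∼? m′
      ... | yes _ | _     | _     | _     = tt
      ... | no _  | yes _ | _     | _     = tt
      ... | no _  | no _  | yes _ | _     = tt
      ... | no _  | no _  | no _  | yes _ = tt
      ... | no ¬a | no ¬b | no ¬c | no ¬d = contradiction c [ ¬a , [ ¬b , [ ¬c , ¬d ]′ ]′ ]′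
      shaped : T (shapedAt P m)
      shaped with to P m ∼? m
      ... | yes Pm∼m = contradiction Pm∼m moved
      ... | no _     = allFin-complete (coveredBy P m) (λ m′ → decide m′ (covered m′))

  solvedBy : List Move → Bool
  solvedBy w = inversePairᵇ (runᴸ w generators)

  solvableᵇ : Bool
  solvableᵇ = not (threeCycleShapedᵇ (product generators)) ∨ (length classes <ᵇ 5)
            ∨ any solvedBy (wordsUpTo 3)

  inversePairᵇ-sound : ∀ t → T (inversePairᵇ t) → InversePair t
  inversePairᵇ-sound (A , B , _) ok m =
    toWitness {a? = to B m ∼? from A m} (allFin-sound (λ m → to B m ≐ from A m) ok m)

  solvableᵇ-sound : T solvableᵇ → Solvable
  solvableᵇ-sound ok shaped many =
    let w , solved = satisfied (any⁻ solvedBy (wordsUpTo 3) found)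
    in w , inversePairᵇ-sound (runᴸ w generators) solved
    where
    found : T (any solvedBy (wordsUpTo 3))
    found = resolve (threeCycleShapedᵇ (product generators)) (length classes <ᵇ 5)
                    (any solvedBy (wordsUpTo 3)) ok (threeCycleShapedᵇ-complete _ shaped)
                    (λ few → <⇒≱ (<ᵇ⇒< (length classes) 5 few) many)

-- v[p] is the largest label of its point, and the labels of one 3-cycle name distinct
-- points; only positions ≥ p are read.
Admissible : Label → Pattern → Set
Admissible p v = toℕ p ≤ toℕ (lookup v p) × lookup v (lookup v p) ≡ lookup v p
               × Apart (next p) × Apart (next (next p))
  where
  Apart : Label → Set
  Apart q = toℕ p < toℕ q → lookup v q ≢ lookup v p

admissible? : ∀ p v → Dec (Admissible p v)
admissible? p v = toℕ p ≤? toℕ (lookup v p) ×-dec lookup v (lookup v p) ≟ lookup v p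
                  ×-dec apart? (next p) ×-dec apart? (next (next p))
  where
  apart? : ∀ q → Dec (toℕ p < toℕ q → lookup v q ≢ lookup v p)
  apart? q = toℕ p <? toℕ q →-dec ¬? (lookup v q ≟ lookup v p)

open PrunedSearch Admissible (T ∘ OnPattern.solvableᵇ) admissible? (T? ∘ OnPattern.solvableᵇ)

-- Decided by evaluation during type checking; the search visits 2971 admissible patterns.
opaque
  unfolding OnPattern.threeCycleShapedᵇ
  every-admissible-pattern-solvable : Extensions 9 ≤-refl (replicate 9 0F)
  every-admissible-pattern-solvable = from-yes (extensions? 9 ≤-refl (replicate 9 0F))

-- From labels to points

IsCycleOn : Perm n → Fin n → Fin n → Fin n → Set
IsCycleOn {n} σ a b c = σ ⟨$⟩ʳ a ≡ b × σ ⟨$⟩ʳ b ≡ c × σ ⟨$⟩ʳ c ≡ a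
                      × (∀ (x : Fin n) → x ≢ a → x ≢ b → x ≢ c → σ ⟨$⟩ʳ x ≡ x)

stepᴮ : Move → (Fin (3 + r) → Perm n) → (Fin (3 + r) → Perm n)
stepᴮ Q₁   h = Q h 0F 1F
stepᴮ Q₁⁻¹ h = Qinv h 0F 1F
stepᴮ Q₂   h = Q h 1F 2F
stepᴮ Q₂⁻¹ h = Qinv h 1F 2F

step-braids : ∀ μ {h g′ : Fin (3 + r) → Perm n} → Braids (stepᴮ μ h) g′ → Braids h g′
step-braids Q₁   = br-Q 0F 1F refl
step-braids Q₁⁻¹ = br-Qinv 0F 1F refl
step-braids Q₂   = br-Q 1F 2F refl
step-braids Q₂⁻¹ = br-Qinv 1F 2F refl

module Realisation {n : ℕ} (pts : Label → Fin n) where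

  representative : Fin n → Label
  representative y = greatest (λ j → pts j ≟ y)

  shape : Pattern
  shape = tabulate (representative ∘ pts)

  open OnPattern shape public

  lookup-shape : ∀ m → lookup shape m ≡ representative (pts m)
  lookup-shape = lookup∘tabulate (representative ∘ pts)

  shape-point : ∀ m → pts (lookup shape m) ≡ pts m
  shape-point m = trans (cong pts (lookup-shape m)) (greatest-satisfies (λ j → pts j ≟ pts m) refl)

  shape-≥ : ∀ m → toℕ m ≤ toℕ (lookup shape m)
  shape-≥ m = subst (λ c → toℕ m ≤ toℕ c) (sym (lookup-shape m))
                    (greatest-≥ (λ j → pts j ≟ pts m) {m} refl)

  ∼⇒≡ : ∀ {m m′} → m ∼ m′ → pts m ≡ pts m′
  ∼⇒≡ {m} {m′} m∼m′ = trans (sym (shape-point m)) (trans (cong pts m∼m′) (shape-point m′))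

  ≡⇒∼ : ∀ {m m′} → pts m ≡ pts m′ → m ∼ m′
  ≡⇒∼ {m} {m′} eq = trans (lookup-shape m) (trans (cong representative eq) (sym (lookup-shape m′)))

  shape-idempotent : ∀ m → lookup shape (lookup shape m) ≡ lookup shape m
  shape-idempotent m = ≡⇒∼ (shape-point m)

  shape-locallyAdmissible : (∀ p → pts (next p) ≢ pts p × pts (next (next p)) ≢ pts p) →
                            LocallyAdmissible shape
  shape-locallyAdmissible apart p u agree =
    p≤u[p] , idempotent , separated (proj₁ (apart p)) , separated (proj₂ (apart p))
    where
    u[p] : lookup u p ≡ lookup shape p
    u[p] = agree p ≤-refl
    p≤u[p] : toℕ p ≤ toℕ (lookup u p)
    p≤u[p] = subst (λ c → toℕ p ≤ toℕ c) (sym u[p]) (shape-≥ p)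
    idempotent : lookup u (lookup u p) ≡ lookup u p
    idempotent = begin
      lookup u (lookup u p)         ≡⟨ cong (lookup u) u[p] ⟩
      lookup u (lookup shape p)     ≡⟨ agree _ (shape-≥ p) ⟩
      lookup shape (lookup shape p) ≡⟨ shape-idempotent p ⟩
      lookup shape p                ≡⟨ sym u[p] ⟩
      lookup u p                    ∎
      where open ≡-Reasoning
    separated : ∀ {q} → pts q ≢ pts p → toℕ p < toℕ q → lookup u q ≢ lookup u p
    separated q≢p p<q u[q]≡u[p] = q≢p (∼⇒≡ (trans (sym (agree _ (<⇒≤ p<q))) (trans u[q]≡u[p] u[p])))

  Outside : Fin n → Set
  Outside y = ∄[ m ] pts m ≡ y

  record Realises (F : LabelPerm) (σ : Perm n) : Set where
    field
      on-points     : ∀ m → σ ⟨$⟩ʳ pts m ≡ pts (to F m)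
      on-points⁻¹   : ∀ m → σ ⟨$⟩ˡ pts m ≡ pts (from F m)
      fixes-outside : ∀ {y} → Outside y → σ ⟨$⟩ʳ y ≡ y

  open Realises

  ⊙-realises : ∀ {F G σ τ} → Realises F σ → Realises G τ → Realises (F ⊙ G) (σ · τ)
  on-points (⊙-realises {F} {G} {σ} {τ} rF rG) m = begin
    τ ⟨$⟩ʳ (σ ⟨$⟩ʳ pts m) ≡⟨ cong (τ ⟨$⟩ʳ_) (on-points rF m) ⟩
    τ ⟨$⟩ʳ pts (to F m)   ≡⟨ on-points rG (to F m) ⟩
    pts (to G (to F m))   ≡⟨ cong pts (lookup∘tabulate (to G ∘ to F) m) ⟨
    pts (to (F ⊙ G) m)    ∎
    where open ≡-Reasoning
  on-points⁻¹ (⊙-realises {F} {G} {σ} {τ} rF rG) m = begin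
    σ ⟨$⟩ˡ (τ ⟨$⟩ˡ pts m)   ≡⟨ cong (σ ⟨$⟩ˡ_) (on-points⁻¹ rG m) ⟩
    σ ⟨$⟩ˡ pts (from G m)   ≡⟨ on-points⁻¹ rF (from G m) ⟩
    pts (from F (from G m)) ≡⟨ cong pts (lookup∘tabulate (from F ∘ from G) m) ⟨
    pts (from (F ⊙ G) m)    ∎
    where open ≡-Reasoning
  fixes-outside (⊙-realises {τ = τ} rF rG) out =
    trans (cong (τ ⟨$⟩ʳ_) (fixes-outside rF out)) (fixes-outside rG out)

  ⁻¹-realises : ∀ {F σ} → Realises F σ → Realises (F ⁻¹ᴸ) (σ ⁻¹)
  on-points     (⁻¹-realises rF) = on-points⁻¹ rF
  on-points⁻¹   (⁻¹-realises rF) = on-points rF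
  fixes-outside (⁻¹-realises {σ = σ} rF) out = ⟨$⟩ʳ⇒⟨$⟩ˡ σ (fixes-outside rF out)

  cycle-realises : ∀ {σ} i j k → IsCycleOn σ (pts i) (pts j) (pts k) → Realises (cycleᴸ i j k) σ
  cycle-realises {σ} i j k (σi , σj , σk , fixes) = record
    { on-points     = λ m → trans (forward m) (cong pts (sym (lookup∘tabulate (rotate i j k) m)))
    ; on-points⁻¹   = λ m → trans (backward m) (cong pts (sym (lookup∘tabulate (rotate k j i) m)))
    ; fixes-outside = λ out → fixes _ (out ∘ (i ,_) ∘ sym) (out ∘ (j ,_) ∘ sym) (out ∘ (k ,_) ∘ sym)
    }
    where
    forward : ∀ m → σ ⟨$⟩ʳ pts m ≡ pts (rotate i j k m)
    forward m with m ∼? i | m ∼? j | m ∼? k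
    ... | yes m∼i | _       | _       = trans (cong (σ ⟨$⟩ʳ_) (∼⇒≡ m∼i)) σi
    ... | no _    | yes m∼j | _       = trans (cong (σ ⟨$⟩ʳ_) (∼⇒≡ m∼j)) σj
    ... | no _    | no _    | yes m∼k = trans (cong (σ ⟨$⟩ʳ_) (∼⇒≡ m∼k)) σk
    ... | no m≁i  | no m≁j  | no m≁k  = fixes (pts m) (m≁i ∘ ≡⇒∼) (m≁j ∘ ≡⇒∼) (m≁k ∘ ≡⇒∼)
    backward : ∀ m → σ ⟨$⟩ˡ pts m ≡ pts (rotate k j i m)
    backward m with m ∼? k | m ∼? j | m ∼? i
    ... | yes m∼k | _       | _       = trans (cong (σ ⟨$⟩ˡ_) (∼⇒≡ m∼k)) (⟨$⟩ʳ⇒⟨$⟩ˡ σ σj)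
    ... | no _    | yes m∼j | _       = trans (cong (σ ⟨$⟩ˡ_) (∼⇒≡ m∼j)) (⟨$⟩ʳ⇒⟨$⟩ˡ σ σi)
    ... | no _    | no _    | yes m∼i = trans (cong (σ ⟨$⟩ˡ_) (∼⇒≡ m∼i)) (⟨$⟩ʳ⇒⟨$⟩ˡ σ σk)
    ... | no m≁k  | no m≁j  | no m≁i  = ⟨$⟩ʳ⇒⟨$⟩ˡ σ (fixes (pts m) (m≁i ∘ ≡⇒∼) (m≁j ∘ ≡⇒∼) (m≁k ∘ ≡⇒∼))

  realised-inverse : ∀ {A B σ τ} → Realises A σ → Realises B τ → (∀ m → to B m ∼ from A m) →
                     τ ≈ σ ⁻¹
  realised-inverse {σ = σ} rA rB B∼A⁻¹ y with any? (λ m → pts m ≟ y)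
  ... | yes (m , refl) = trans (on-points rB m) (trans (∼⇒≡ (B∼A⁻¹ m)) (sym (on-points⁻¹ rA m)))
  ... | no out         = trans (fixes-outside rB out) (sym (⟨$⟩ʳ⇒⟨$⟩ˡ σ (fixes-outside rA out)))

  realised-threeCycleShaped : ∀ {P σ} → Realises P σ → IsThreeCycle σ → ThreeCycleShaped P
  realised-threeCycleShaped {P} {σ} rP (x , y , z , x≢y , _ , _ , σx , σy , _ , fixes)
    with any? (λ m → pts m ≟ x)
  ... | no out         = contradiction (trans (sym (fixes-outside rP out)) σx) x≢y
  ... | yes (m , refl) = m , moved , covered
    where
    Pm≡y : pts (to P m) ≡ y
    Pm≡y = trans (sym (on-points rP m)) σx
    PPm≡z : pts (to P (to P m)) ≡ z
    PPm≡z = trans (sym (on-points rP (to P m))) (trans (cong (σ ⟨$⟩ʳ_) Pm≡y) σy)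
    moved : ¬ (to P m ∼ m)
    moved Pm∼m = x≢y (trans (sym (∼⇒≡ Pm∼m)) Pm≡y)
    covered : ∀ m′ → m′ ∼ m ⊎ m′ ∼ to P m ⊎ m′ ∼ to P (to P m) ⊎ to P m′ ∼ m′
    covered m′ with pts m′ ≟ pts m | pts m′ ≟ y | pts m′ ≟ z
    ... | yes ≡x | _      | _      = inj₁ (≡⇒∼ ≡x)
    ... | no _   | yes ≡y | _      = inj₂ (inj₁ (≡⇒∼ (trans ≡y (sym Pm≡y))))
    ... | no _   | no _   | yes ≡z = inj₂ (inj₂ (inj₁ (≡⇒∼ (trans ≡z (sym PPm≡z)))))
    ... | no ≢x  | no ≢y  | no ≢z  =
      inj₂ (inj₂ (inj₂ (≡⇒∼ (trans (sym (on-points rP m′)) (fixes (pts m′) ≢x ≢y ≢z)))))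

  points⊆image-classes : ∀ m → pts m ∈ image pts classes
  points⊆image-classes m = subst (_∈ image pts classes) (shape-point m)
    (∈-image pts (∈-filter⁺ (λ c → lookup shape c ≟ c) (∈-allFin (lookup shape m)) (shape-idempotent m)))

  transitive⇒5≤classes : ∀ {A B C σ₀ σ₁ σ₂} → Realises A σ₀ → Realises B σ₁ → Realises C σ₂ →
                         TransOnFive σ₀ σ₁ σ₂ → 5 ≤ length classes
  transitive⇒5≤classes rA rB rC (S , ∣S∣≡5 , _ , transitive) = begin
    5                     ≡⟨ ∣S∣≡5 ⟨
    ∣ S ∣                 ≤⟨ p⊆q⇒∣p∣≤∣q∣ S⊆image ⟩
    ∣ image pts classes ∣ ≤⟨ ∣image∣≤length pts classes ⟩
    length classes        ∎
    where
    open ≤-Reasoning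
    S⊆image : S ⊆ image pts classes
    S⊆image {p} p∈S with any? (λ m → pts m ≟ p)
    ... | yes (m , refl) = points⊆image-classes m
    ... | no out = contradiction (subst (_≤ 1) ∣S∣≡5 (subst (∣ S ∣ ≤_) (∣⁅x⁆∣≡1 p) (p⊆q⇒∣p∣≤∣q∣ S⊆⁅p⁆)))
                                 λ { (s≤s ()) }
      where
      S⊆⁅p⁆ : S ⊆ ⁅ p ⁆
      S⊆⁅p⁆ {q} q∈S =
        let σ , σ∈ , σp≡q = transitive p q p∈S q∈S
            σp≡p = InGen-fixes σ∈ λ { 0F → fixes-outside rA out ; 1F → fixes-outside rB out
                                    ; 2F → fixes-outside rC out }
        in subst (_∈ ⁅ p ⁆) (trans (sym σp≡p) σp≡q) (x∈⁅x⁆ p)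

  Realises₃ : Triple → (Fin (3 + r) → Perm n) → Set
  Realises₃ (A , B , C) h = Realises A (h 0F) × Realises B (h 1F) × Realises C (h 2F)

  step-realises : ∀ μ {t} {h : Fin (3 + r) → Perm n} → Realises₃ t h →
                  Realises₃ (stepᴸ μ t) (stepᴮ μ h)
  step-realises Q₁   (rA , rB , rC) = ⊙-realises (⊙-realises rA rB) (⁻¹-realises rA) , rA , rC
  step-realises Q₁⁻¹ (rA , rB , rC) = rB , ⊙-realises (⊙-realises (⁻¹-realises rB) rA) rB , rC
  step-realises Q₂   (rA , rB , rC) = rA , ⊙-realises (⊙-realises rB rC) (⁻¹-realises rB) , rB
  step-realises Q₂⁻¹ (rA , rB , rC) = rA , rC , ⊙-realises (⊙-realises (⁻¹-realises rC) rB) rC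

  product-realises : ∀ {t} {h : Fin (3 + r) → Perm n} → Realises₃ t h →
                     Realises (product t) (h 0F · h 1F · h 2F)
  product-realises {t = A , B , C} (rA , rB , rC) = ⊙-realises (⊙-realises rA rB) rC

  run-sound : ∀ w {t} {h : Fin (3 + r) → Perm n} → Realises₃ t h → InversePair (runᴸ w t) →
              ∃[ g′ ] Braids h g′ × g′ 1F ≈ g′ 0F ⁻¹
  run-sound []      {h = h} (rA , rB , _) inverse =
    h , br-refl (λ _ _ → refl) , realised-inverse rA rB inverse
  run-sound (μ ∷ w) realised inverse =
    let g′ , h→g′ , g′-inverse = run-sound w (step-realises μ realised) inverse
    in g′ , step-braids μ h→g′ , g′-inverse

front-triple⇒inverse-pair : (h : Fin (3 + r) → Perm n) {σ₀ σ₁ σ₂ : Perm n} →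
  h 0F ≡ σ₀ → h 1F ≡ σ₁ → h 2F ≡ σ₂ →
  IsThreeCycle σ₀ → IsThreeCycle σ₁ → IsThreeCycle σ₂ →
  IsThreeCycle (σ₀ · σ₁ · σ₂) → TransOnFive σ₀ σ₁ σ₂ →
  ∃[ g′ ] Braids h g′ × g′ 1F ≈ g′ 0F ⁻¹
front-triple⇒inverse-pair {n = n} h refl refl refl
  (a₀ , b₀ , c₀ , a₀≢b₀ , b₀≢c₀ , a₀≢c₀ , on₀) (a₁ , b₁ , c₁ , a₁≢b₁ , b₁≢c₁ , a₁≢c₁ , on₁)
  (a₂ , b₂ , c₂ , a₂≢b₂ , b₂≢c₂ , a₂≢c₂ , on₂) product-cycle transitive =
  let w , inverse = solvable
        (realised-threeCycleShaped (product-realises {h = h} realised) product-cycle)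
        (transitive⇒5≤classes r₀ r₁ r₂ transitive)
  in run-sound w {generators} {h} realised inverse
  where
  pts : Label → Fin n
  pts = lookup (a₀ ∷ b₀ ∷ c₀ ∷ a₁ ∷ b₁ ∷ c₁ ∷ a₂ ∷ b₂ ∷ c₂ ∷ [])
  open Realisation pts
  r₀ : Realises (cycleᴸ 0F 1F 2F) (h 0F)
  r₀ = cycle-realises 0F 1F 2F on₀
  r₁ : Realises (cycleᴸ 3F 4F 5F) (h 1F)
  r₁ = cycle-realises 3F 4F 5F on₁
  r₂ : Realises (cycleᴸ 6F 7F 8F) (h 2F)
  r₂ = cycle-realises 6F 7F 8F on₂
  realised : Realises₃ generators h
  realised = r₀ , r₁ , r₂
  apart : ∀ p → pts (next p) ≢ pts p × pts (next (next p)) ≢ pts p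
  apart 0F = ≢-sym a₀≢b₀ , ≢-sym a₀≢c₀
  apart 1F = ≢-sym b₀≢c₀ , a₀≢b₀
  apart 2F = a₀≢c₀ , b₀≢c₀
  apart 3F = ≢-sym a₁≢b₁ , ≢-sym a₁≢c₁
  apart 4F = ≢-sym b₁≢c₁ , a₁≢b₁
  apart 5F = a₁≢c₁ , b₁≢c₁
  apart 6F = ≢-sym a₂≢b₂ , ≢-sym a₂≢c₂
  apart 7F = ≢-sym b₂≢c₂ , a₂≢b₂
  apart 8F = a₂≢c₂ , b₂≢c₂
  solvable : Solvable
  solvable = solvableᵇ-sound
    (extensions-sound {shape} (shape-locallyAdmissible apart) 9 ≤-refl (replicate 9 0F)
       (λ q 9≤q → contradiction 9≤q (<⇒≱ (toℕ<n q))) every-admissible-pattern-solvable)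

increasing⇒3≤ : {i j k : Fin r} → toℕ i < toℕ j → toℕ j < toℕ k → 3 ≤ r
increasing⇒3≤ {k = k} i<j j<k = ≤-trans (s≤s (≤-trans (s≤s (≤-trans (s≤s z≤n) i<j)) j<k)) (toℕ<n k)

inverse-at-front : {g : Fin (3 + r) → Perm n} → g 1F ≈ g 0F ⁻¹ →
                   ∀ a b → toℕ a ≡ 0 → toℕ b ≡ 1 → g b ≈ (g a) ⁻¹
inverse-at-front inverse zero    (suc zero)    _  _  = inverse
inverse-at-front inverse zero    zero          _  ()
inverse-at-front inverse zero    (suc (suc _)) _  ()
inverse-at-front inverse (suc _) _             () _

lemma4p5 : ∀ (n r : ℕ) (g : Fin r → Perm n) → InNi n r g →
           ∀ (i j k : Fin r) → toℕ i < toℕ j → toℕ j < toℕ k →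
           TransOnFive (g i) (g j) (g k) →
           IsThreeCycle (g i · g j · g k) →
           ∃[ g′ ] ( Braids g g′
                   × (∀ (a b : Fin r) → toℕ a ≡ 0 → toℕ b ≡ 1 →
                        g′ b ≈ (g′ a) ⁻¹) )
lemma4p5 n r g (cycles , _) i j k i<j j<k transitive product-cycle with increasing⇒3≤ i<j j<k
... | s≤s (s≤s (s≤s _)) =
  let h , g→h , h[0]≡g[i] , h[1]≡g[j] , h[2]≡g[k] = gather g i j k i<j j<k
      g′ , h→g′ , inverse = front-triple⇒inverse-pair h h[0]≡g[i] h[1]≡g[j] h[2]≡g[k]
                              (cycles i) (cycles j) (cycles k) product-cycle transitive
  in g′ , Braids-trans g→h h→g′ , inverse-at-front {g = g′} inverse
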